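{- Let $a=a_1\cdots a_p$ and $b=b_1\cdots b_q$ be words in $W$ whose $p+q$ entries are pairwise distinct, and assume $b$ is a non-trivial wave. Let $0\le x\le p$ be maximal such that $a_1<a_2<\cdots<a_x<b_q$ (with $x=0$ if $a_1>b_q$), and set $\mathsf{ins}(a,b)=a_1\cdots a_x\,b_1\cdots b_q\,a_{x+1}\cdots a_p$. Then $$\mathsf{sw}(\mathsf{ins}(a,b))=b,\qquad \mathsf{ins}(a,b)\setminus\mathsf{sw}(\mathsf{ins}(a,b))=a,$$ and, for every $w\in W$ whose entries are not in increasing order, $\mathsf{ins}(w\setminus\mathsf{sw}(w),\mathsf{sw}(w))=w$.
   Context: $W$ is the set of all finite words ($\ell\ge0$) of positive integers with pairwise distinct entries. Wave: a nonempty word $w=w_1\cdots w_\ell$ with $c$ the position of its maximal entry is a (non-trivial) wave if $c\ne\ell$ and $w_\ell<w_{\ell-1}<\cdots<w_{c+1}<w_1<w_2<\cdots<w_c$; an increasing word (case $c=\ell$) is called a trivial wave. Special wave: let $w=w_1\cdots w_\ell\in W$ be nonempty. If the entries of $w$ are increasing, $\mathsf{sw}(w)=w$ and $w\setminus\mathsf{sw}(w)$ is empty. Otherwise let $t$ be minimal with $w_t>w_{t+1}$; let $r$ be minimal with $1\le r\le t$ and $w_r>w_{t+1}$; set $w_0=0$ and let $s$ be maximal with $t<s\le\ell$ and $w_{t+1}>w_{t+2}>\cdots>w_s>w_{r-1}$. Then $\mathsf{sw}(w)=w_rw_{r+1}\cdots w_s$ and $w\setminus\mathsf{sw}(w)=w_1\cdots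 w_{r-1}w_{s+1}\cdots w_\ell$. -}

module Defs where

open import Data.Nat using (ℕ; zero; suc; _+_; _∸_; _≤_; _<_; _<ᵇ_; _≡ᵇ_)
open import Data.Bool using (Bool; true; false; if_then_else_; _∧_; _∨_)
open import Data.Maybe using (Maybe; just; nothing; fromMaybe)
open import Data.List using (List; []; _∷_; length; take; drop; _++_)
open import Data.List.Relation.Unary.All using (All)
open import Data.List.Relation.Unary.Unique.Propositional using (Unique)
open import Data.Product using (Σ; ∃-syntax; _×_)

-- Entries are 1-indexed:
-- at w i = w_i for 1 ≤ i ≤ ℓ, with the convention w_0 = 0 (as in the paper);
-- out-of-range positions also give 0 (never used in a relevant way).
at : List ℕ → ℕ → ℕ
at w zero = 0
at [] (suc i) = 0
at (x ∷ xs) (suc zero) = x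
at (x ∷ xs) (suc (suc i)) = at xs (suc i)

InW : List ℕ → Set
InW w = All (0 <_) w × Unique w

minSearch : (ℕ → Bool) → ℕ → ℕ → Maybe ℕ
minSearch P lo zero = nothing
minSearch P lo (suc n) = if P lo then just lo else minSearch P (suc lo) n

maxSearch : (ℕ → Bool) → ℕ → ℕ → Maybe ℕ
maxSearch P lo zero = nothing
maxSearch P lo (suc n) = if P (lo + n) then just (lo + n) else maxSearch P lo n

allRange : (ℕ → Bool) → ℕ → ℕ → Bool
allRange P lo zero = true
allRange P lo (suc n) = P lo ∧ allRange P (suc lo) n

IsWave : List ℕ → Set
IsWave w = ∃[ c ]
  ( 1 ≤ c × c < length w
  × (∀ i → 1 ≤ i → i ≤ length w → at w i ≤ at w c)
  × (∀ i → 1 ≤ i → i < c → at w i < at w (suc i))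
  × at w (suc c) < at w 1
  × (∀ i → suc c ≤ i → i < length w → at w (suc i) < at w i) )

firstDescent : List ℕ → Maybe ℕ
firstDescent w = minSearch (λ j → at w (suc j) <ᵇ at w j) 1 (length w ∸ 1)

rIdx : List ℕ → ℕ → ℕ
rIdx w t = fromMaybe t (minSearch (λ j → at w (suc t) <ᵇ at w j) 1 t)

sIdx : List ℕ → ℕ → ℕ → ℕ
sIdx w t r = fromMaybe (suc t)
  (maxSearch (λ j → allRange (λ k → at w (suc k) <ᵇ at w k) (suc t) (j ∸ suc t)
                    ∧ (at w (r ∸ 1) <ᵇ at w j))
             (suc t) (length w ∸ t))

sw : List ℕ → List ℕ
sw w with firstDescent w
... | nothing = w
... | just t = take (suc (sIdx w t (rIdx w t)) ∸ rIdx w t) (drop (rIdx w t ∸ 1) w)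

swRest : List ℕ → List ℕ
swRest w with firstDescent w
... | nothing = []
... | just t = take (rIdx w t ∸ 1) w ++ drop (sIdx w t (rIdx w t)) w

insIdx : List ℕ → List ℕ → ℕ
insIdx a b = fromMaybe 0
  (maxSearch (λ j → allRange (λ k → at a k <ᵇ at a (suc k)) 1 (j ∸ 1)
                    ∧ ((j ≡ᵇ 0) ∨ (at a j <ᵇ at b (length b))))
             0 (suc (length a)))

ins : List ℕ → List ℕ → List ℕ
ins a b = take (insIdx a b) a ++ b ++ drop (insIdx a b) a

module Submission where

-- Everything happens in one configuration xs ++ ys ++ zs, recorded by Insertable: xs is
-- increasing with its last entry below the last entry of ys, and the first entry of zs cannot continue
-- that run while staying below it. This says precisely that length xs is the insertion index x of
-- ins (xs ++ zs) ys. If ys is moreover a wave, then in xs ++ ys ++ zs the first descent is at the peak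
-- of ys; everything in xs lies below the last entry of ys, hence below the entry after the peak, so the
-- special wave starts right after xs; and it ends at the last entry of ys, because descending further
-- into zs is exactly what the blocking condition forbids. Conversely, the indices t, r, s of an unsorted
-- w cut it as w_1..w_{r-1} ++ sw(w) ++ w_{s+1}..w_ℓ, and the maximality of s is again the blocking
-- condition, so ins inserts sw(w) back where it came from.

open import Defs
open import Data.Bool using (Bool; true; false)
open import Data.List using (List; []; _∷_; length; take; drop; _++_)
open import Data.List.Properties using (length-++; length-drop; take++drop≡id; drop-drop)
open import Data.List.Relation.Unary.All using (All; _∷_)
open import Data.List.Relation.Unary.All.Properties using (++⁺; take⁺; drop⁺)
open import Data.List.Relation.Unary.AllPairs using (_∷_)
open import Data.List.Relation.Unary.Linked using (Linked; []; [-]; _∷_)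
open import Data.List.Relation.Unary.Unique.Propositional using (Unique)
open import Data.Maybe using (Maybe; just; nothing; fromMaybe)
open import Data.Nat using (ℕ; zero; suc; _+_; _∸_; _≤_; _<_; _>_; _≥_; _<ᵇ_; z≤n; s≤s; s≤s⁻¹; z<s)
open import Data.Nat.Properties
open import Data.Product using (_×_; _,_; proj₁; proj₂; ∃-syntax)
open import Data.Sum using (_⊎_; inj₁; inj₂)
open import Function using (flip)
open import Level using (0ℓ)
open import Relation.Binary using (Rel; _⇒_; Reflexive; Transitive; tri<; tri≈; tri>)
open import Relation.Binary.PropositionalEquality using (_≡_; _≢_; refl; sym; trans; cong; cong₂; subst; subst₂; module ≡-Reasoning)
open import Relation.Nullary using (¬_; contradiction)
open import Relation.Nullary.Reflects using (Reflects; ofʸ; ofⁿ; fromEquivalence; _×-reflects_; _⊎-reflects_)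

Chain : Rel ℕ 0ℓ → (ℕ → ℕ) → ℕ → ℕ → Set
Chain _R_ f i j = ∀ k → i ≤ k → k < j → f k R f (suc k)

Ascending Descending : (ℕ → ℕ) → ℕ → ℕ → Set
Ascending  = Chain _<_
Descending = Chain _>_

module _ {R : Rel ℕ 0ℓ} where

  chain-cong : ∀ {f g i j} → (∀ k → i ≤ k → k ≤ j → f k ≡ g k) → Chain R f i j → Chain R g i j
  chain-cong f≗g ch k i≤k k<j =
    subst₂ R (f≗g k i≤k (<⇒≤ k<j)) (f≗g (suc k) (m≤n⇒m≤1+n i≤k) k<j) (ch k i≤k k<j)

  chain-join : ∀ {f i j l} → Chain R f i j → R (f j) (f (suc j)) → Chain R f (suc j) l → Chain R f i l
  chain-join {j = j} left step right k i≤k k<l with <-cmp k j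
  ... | tri< k<j _ _ = left k i≤k k<j
  ... | tri≈ _ refl _ = step
  ... | tri> _ _ j<k = right k j<k k<l

  chain-snoc : ∀ {f i j} → Chain R f i j → R (f j) (f (suc j)) → Chain R f i (suc j)
  chain-snoc left step = chain-join left step λ k sj≤k k<sj → contradiction k<sj (≤⇒≯ sj≤k)

  chain-closure : ∀ {S : Rel ℕ 0ℓ} → R ⇒ S → Reflexive S → Transitive S →
               ∀ {f i j k l} → Chain R f i j → i ≤ k → k ≤ l → l ≤ j → S (f k) (f l)
  chain-closure R⇒S refl′ trans′ {l = zero} ch i≤k z≤n l≤j = refl′
  chain-closure R⇒S refl′ trans′ {l = suc l} ch i≤k k≤l l≤j with m≤n⇒m<n∨m≡n k≤l
  ... | inj₂ refl = refl′
  ... | inj₁ k<sl = trans′ (chain-closure R⇒S refl′ trans′ ch i≤k (s≤s⁻¹ k<sl) (<⇒≤ l≤j))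
                           (R⇒S (ch l (≤-trans i≤k (s≤s⁻¹ k<sl)) l≤j))

ascending⇒≤ : ∀ {f i j k l} → Ascending f i j → i ≤ k → k ≤ l → l ≤ j → f k ≤ f l
ascending⇒≤ = chain-closure {R = _<_} <⇒≤ ≤-refl ≤-trans

descending⇒≥ : ∀ {f i j k l} → Descending f i j → i ≤ k → k ≤ l → l ≤ j → f l ≤ f k
descending⇒≥ = chain-closure {R = _>_} {S = _≥_} <⇒≤ ≤-refl (flip ≤-trans)

at-++ˡ : ∀ xs {ys i} → i ≤ length xs → at (xs ++ ys) i ≡ at xs i
at-++ˡ xs       {i = zero}        _         = refl
at-++ˡ (x ∷ xs) {i = suc zero}    _         = refl
at-++ˡ (x ∷ xs) {i = suc (suc i)} (s≤s i<n) = at-++ˡ xs i<n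

at-++ʳ : ∀ xs {ys} j → at (xs ++ ys) (suc (length xs + j)) ≡ at ys (suc j)
at-++ʳ []       j = refl
at-++ʳ (x ∷ xs) j = at-++ʳ xs j

at-++ʳ′ : ∀ xs {ys j} → 1 ≤ j → at (xs ++ ys) (length xs + j) ≡ at ys j
at-++ʳ′ xs {j = suc j} _ = trans (cong (at _) (+-suc (length xs) j)) (at-++ʳ xs j)

at-++-length : ∀ xs {ys} → at (xs ++ ys) (suc (length xs)) ≡ at ys 1
at-++-length []       = refl
at-++-length (x ∷ xs) = at-++-length xs

at-take : ∀ n xs {i} → i ≤ n → at (take n xs) i ≡ at xs i
at-take n       xs       {zero}        _         = refl
at-take (suc n) []       {suc i}       _         = refl
at-take (suc n) (x ∷ xs) {suc zero}    _         = refl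
at-take (suc n) (x ∷ xs) {suc (suc i)} (s≤s i<n) = at-take n xs i<n

at-drop : ∀ n xs {j} → 1 ≤ j → at (drop n xs) j ≡ at xs (n + j)
at-drop zero    xs       _ = refl
at-drop (suc n) []       {suc j} _ = refl
at-drop (suc n) (x ∷ xs) {suc j} _ =
  trans (at-drop n xs z<s) (sym (at-∷ (≤-trans z<s (m≤n+m (suc j) n))))
  where
  at-∷ : ∀ {i} → 1 ≤ i → at (x ∷ xs) (suc i) ≡ at xs i
  at-∷ {suc i} _ = refl

at-All : ∀ {P : ℕ → Set} {xs i} → All P xs → 1 ≤ i → i ≤ length xs → P (at xs i)
at-All {xs = x ∷ xs} {suc zero}    (px ∷ _)   _ _         = px
at-All {xs = x ∷ xs} {suc (suc i)} (_ ∷ pxs) _ (s≤s i<n) = at-All pxs z<s i<n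

0<at⇒≤length : ∀ xs {i} → 0 < at xs i → i ≤ length xs
0<at⇒≤length xs       {zero}        _   = z≤n
0<at⇒≤length []       {suc i}       ()
0<at⇒≤length (x ∷ xs) {suc zero}    _   = s≤s z≤n
0<at⇒≤length (x ∷ xs) {suc (suc i)} pos = s≤s (0<at⇒≤length xs pos)

at-injective : ∀ {xs i j} → Unique xs → 1 ≤ i → i < j → j ≤ length xs → at xs i ≢ at xs j
at-injective {x ∷ xs} {suc zero}    {suc (suc j)} (x∉ ∷ _) _ _         (s≤s j<n) = at-All x∉ z<s j<n
at-injective {x ∷ xs} {suc zero}    {suc zero}    _        _ (s≤s ()) _
at-injective {x ∷ xs} {suc (suc i)} {suc (suc j)} (_ ∷ u)  _ (s≤s i<j) (s≤s j<n) = at-injective u z<s i<j j<n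

unique-≯⇒< : ∀ {xs i j} → Unique xs → 1 ≤ i → i < j → j ≤ length xs →
             ¬ (at xs j < at xs i) → at xs i < at xs j
unique-≯⇒< u 1≤i i<j j≤n ≯ = ≤∧≢⇒< (≮⇒≥ ≯) (at-injective u 1≤i i<j j≤n)

ascending⇒linked : ∀ xs → Ascending (at xs) 1 (length xs) → Linked _<_ xs
ascending⇒linked []           _   = []
ascending⇒linked (x ∷ [])     _   = [-]
ascending⇒linked (x ∷ y ∷ xs) asc =
  asc 1 ≤-refl (s≤s z<s) ∷ ascending⇒linked (y ∷ xs) λ where
    zero    ()
    (suc k) _ (s≤s k<n) → asc (suc (suc k)) z<s (s≤s (s≤s k<n))

module _ {R : Rel ℕ 0ℓ} where

  chain-++ʳ : ∀ xs {ys i j} → 1 ≤ i → Chain R (at ys) i j →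
              Chain R (at (xs ++ ys)) (length xs + i) (length xs + j)
  chain-++ʳ xs {ys} {i} {j} 1≤i ch k n+i≤k k<n+j
    with k ∸ length xs | m+[n∸m]≡n (≤-trans (m≤m+n (length xs) i) n+i≤k)
  ... | d | refl = subst₂ R (sym (at-++ʳ′ xs 1≤d)) (sym (at-++ʳ xs d)) (ch d i≤d d<j)
    where
    i≤d : i ≤ d
    i≤d = +-cancelˡ-≤ (length xs) i d n+i≤k
    1≤d : 1 ≤ d
    1≤d = ≤-trans 1≤i i≤d
    d<j : d < j
    d<j = +-cancelˡ-< (length xs) d j k<n+j

take-length-++ : ∀ xs {ys : List ℕ} → take (length xs) (xs ++ ys) ≡ xs
take-length-++ []       = refl
take-length-++ (x ∷ xs) = cong (x ∷_) (take-length-++ xs)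

drop-length-++ : ∀ xs {ys : List ℕ} → drop (length xs) (xs ++ ys) ≡ ys
drop-length-++ []       = refl
drop-length-++ (x ∷ xs) = drop-length-++ xs

length-take-≤ : ∀ n (xs : List ℕ) → n ≤ length xs → length (take n xs) ≡ n
length-take-≤ zero    xs       _         = refl
length-take-≤ (suc n) (x ∷ xs) (s≤s n≤l) = cong suc (length-take-≤ n xs n≤l)

take++take++drop : ∀ {i j} (xs : List ℕ) → i ≤ j → take i xs ++ take (j ∸ i) (drop i xs) ++ drop j xs ≡ xs
take++take++drop {i} {j} xs i≤j = begin
  take i xs ++ take (j ∸ i) (drop i xs) ++ drop j xs
    ≡⟨ cong (λ zs → take i xs ++ take (j ∸ i) (drop i xs) ++ zs) drop-j ⟩
  take i xs ++ take (j ∸ i) (drop i xs) ++ drop (j ∸ i) (drop i xs)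
    ≡⟨ cong (take i xs ++_) (take++drop≡id (j ∸ i) (drop i xs)) ⟩
  take i xs ++ drop i xs
    ≡⟨ take++drop≡id i xs ⟩
  xs ∎
  where
  open ≡-Reasoning
  drop-j : drop j xs ≡ drop (j ∸ i) (drop i xs)
  drop-j = trans (cong (λ k → drop k xs) (sym (m+[n∸m]≡n i≤j))) (sym (drop-drop i (j ∸ i) xs))

record IsLeast (P : ℕ → Set) (lo hi j : ℕ) : Set where
  field
    holds   : P j
    lower   : lo ≤ j
    upper   : j < hi
    minimal : ∀ k → lo ≤ k → k < j → ¬ P k

record IsGreatest (P : ℕ → Set) (lo hi j : ℕ) : Set where
  field
    holds   : P j
    lower   : lo ≤ j
    upper   : j < hi
    maximal : ∀ k → j < k → k < hi → ¬ P k

IsLeast-unique : ∀ {P lo hi hi′ i j} → IsLeast P lo hi i → IsLeast P lo hi′ j → i ≡ j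
IsLeast-unique {i = i} {j} I J with <-cmp i j
... | tri< i<j _ _ = contradiction (IsLeast.holds I) (IsLeast.minimal J i (IsLeast.lower I) i<j)
... | tri≈ _ i≡j _ = i≡j
... | tri> _ _ j<i = contradiction (IsLeast.holds J) (IsLeast.minimal I j (IsLeast.lower J) j<i)

IsGreatest-unique : ∀ {P lo hi i j} → IsGreatest P lo hi i → IsGreatest P lo hi j → i ≡ j
IsGreatest-unique {i = i} {j} I J with <-cmp i j
... | tri< i<j _ _ = contradiction (IsGreatest.holds J) (IsGreatest.maximal I j i<j (IsGreatest.upper J))
... | tri≈ _ i≡j _ = i≡j
... | tri> _ _ j<i = contradiction (IsGreatest.holds I) (IsGreatest.maximal J i j<i (IsGreatest.upper I))

-- minSearch and maxSearch scan [lo, lo + n) but are always called with n = hi ∸ lo, so the interface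
-- below is stated for [lo, hi); the primed versions are the raw [lo, lo + n) statements.
<-+∸⇒< : ∀ {lo hi j} → lo ≤ j → j < lo + (hi ∸ lo) → j < hi
<-+∸⇒< {lo} {hi} {j} lo≤j j< with ≤-total lo hi
... | inj₁ lo≤hi = subst (j <_) (m+[n∸m]≡n lo≤hi) j<
... | inj₂ hi≤lo = contradiction lo≤j (<⇒≱ (subst (j <_) lo+0≡lo j<))
  where
  lo+0≡lo : lo + (hi ∸ lo) ≡ lo
  lo+0≡lo = trans (cong (lo +_) (m≤n⇒m∸n≡0 hi≤lo)) (+-identityʳ lo)

<⇒<-+∸ : ∀ lo {hi j} → j < hi → j < lo + (hi ∸ lo)
<⇒<-+∸ lo {hi} j<hi = ≤-trans j<hi (m≤n+m∸n hi lo)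

module _ {P : ℕ → Set} {p : ℕ → Bool} (P? : ∀ k → Reflects (P k) (p k)) where

  private
    lo<lo+1+n : ∀ lo n → lo < lo + suc n
    lo<lo+1+n lo n = m<m+n lo z<s

    minSearch-just′ : ∀ lo n {j} → minSearch p lo n ≡ just j → IsLeast P lo (lo + n) j
    minSearch-just′ lo (suc n) {j} e with p lo | P? lo
    minSearch-just′ lo (suc n) refl | true | ofʸ Plo = record
      { holds = Plo ; lower = ≤-refl ; upper = lo<lo+1+n lo n
      ; minimal = λ k lo≤k k<lo → contradiction lo≤k (<⇒≱ k<lo) }
    ... | false | ofⁿ ¬Plo = record
      { holds = holds ; lower = <⇒≤ lower ; upper = subst (j <_) (sym (+-suc lo n)) upper
      ; minimal = minimal′ }
      where
      open IsLeast (minSearch-just′ (suc lo) n e)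
      minimal′ : ∀ k → lo ≤ k → k < _ → ¬ P k
      minimal′ k lo≤k k<j with m≤n⇒m<n∨m≡n lo≤k
      ... | inj₁ lo<k = minimal k lo<k k<j
      ... | inj₂ refl = ¬Plo

    minSearch-nothing′ : ∀ lo n → minSearch p lo n ≡ nothing → ∀ k → lo ≤ k → k < lo + n → ¬ P k
    minSearch-nothing′ lo zero    _ k lo≤k k<lo = contradiction lo≤k (<⇒≱ (subst (k <_) (+-identityʳ lo) k<lo))
    minSearch-nothing′ lo (suc n) e k lo≤k k< with p lo | P? lo
    ... | false | ofⁿ ¬Plo with m≤n⇒m<n∨m≡n lo≤k
    ...   | inj₁ lo<k = minSearch-nothing′ (suc lo) n e k lo<k (subst (k <_) (+-suc lo n) k<)
    ...   | inj₂ refl = ¬Plo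

    maxSearch-just′ : ∀ lo n {j} → maxSearch p lo n ≡ just j → IsGreatest P lo (lo + n) j
    maxSearch-just′ lo (suc n) e with p (lo + n) | P? (lo + n)
    maxSearch-just′ lo (suc n) refl | true | ofʸ Pj = record
      { holds = Pj ; lower = m≤m+n lo n ; upper = last<
      ; maximal = λ k j<k k< → contradiction j<k (≤⇒≯ (s≤s⁻¹ (subst (k <_) (+-suc lo n) k<))) }
      where
      last< : lo + n < lo + suc n
      last< = +-monoʳ-< lo (n<1+n n)
    ... | false | ofⁿ ¬Pl = record
      { holds = holds ; lower = lower ; upper = <-trans upper (+-monoʳ-< lo (n<1+n n))
      ; maximal = maximal′ }
      where
      open IsGreatest (maxSearch-just′ lo n e)
      maximal′ : ∀ k → _ < k → k < lo + suc n → ¬ P k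
      maximal′ k j<k k< with m≤n⇒m<n∨m≡n (s≤s⁻¹ (subst (k <_) (+-suc lo n) k<))
      ... | inj₁ k<l = maximal k j<k k<l
      ... | inj₂ refl = ¬Pl

    maxSearch-nothing′ : ∀ lo n → maxSearch p lo n ≡ nothing → ∀ k → lo ≤ k → k < lo + n → ¬ P k
    maxSearch-nothing′ lo zero    _ k lo≤k k<lo = contradiction lo≤k (<⇒≱ (subst (k <_) (+-identityʳ lo) k<lo))
    maxSearch-nothing′ lo (suc n) e k lo≤k k< with p (lo + n) | P? (lo + n)
    ... | false | ofⁿ ¬Pl with m≤n⇒m<n∨m≡n (s≤s⁻¹ (subst (k <_) (+-suc lo n) k<))
    ...   | inj₁ k<l = maxSearch-nothing′ lo n e k lo≤k k<l
    ...   | inj₂ refl = ¬Pl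

    allRange-reflects′ : ∀ lo n → Reflects (∀ k → lo ≤ k → k < lo + n → P k) (allRange p lo n)
    allRange-reflects′ lo zero = ofʸ λ k lo≤k k<lo → contradiction lo≤k (<⇒≱ (subst (k <_) (+-identityʳ lo) k<lo))
    allRange-reflects′ lo (suc n) with p lo | P? lo
    ... | false | ofⁿ ¬Plo = ofⁿ λ all → ¬Plo (all lo ≤-refl (lo<lo+1+n lo n))
    ... | true  | ofʸ Plo with allRange p (suc lo) n | allRange-reflects′ (suc lo) n
    ...   | false | ofⁿ ¬rest = ofⁿ λ all → ¬rest λ k lo<k k< → all k (<⇒≤ lo<k) (subst (k <_) (sym (+-suc lo n)) k<)
    ...   | true  | ofʸ rest = ofʸ all
      where
      all : ∀ k → lo ≤ k → k < lo + suc n → P k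
      all k lo≤k k< with m≤n⇒m<n∨m≡n lo≤k
      ... | inj₁ lo<k = rest k lo<k (subst (k <_) (+-suc lo n) k<)
      ... | inj₂ refl = Plo

  minSearch-nothing : ∀ {lo hi} → minSearch p lo (hi ∸ lo) ≡ nothing → ∀ k → lo ≤ k → k < hi → ¬ P k
  minSearch-nothing {lo} {hi} e k lo≤k k<hi = minSearch-nothing′ lo (hi ∸ lo) e k lo≤k (<⇒<-+∸ lo k<hi)

  minSearch-just : ∀ {lo hi j} → minSearch p lo (hi ∸ lo) ≡ just j → IsLeast P lo hi j
  minSearch-just {lo} {hi} e = record { holds = holds ; lower = lower ; upper = <-+∸⇒< lower upper ; minimal = minimal }
    where open IsLeast (minSearch-just′ lo (hi ∸ lo) e)

  minSearch-least : ∀ {lo hi j} → IsLeast P lo hi j → minSearch p lo (hi ∸ lo) ≡ just j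
  minSearch-least {lo} {hi} J with minSearch p lo (hi ∸ lo) in e
  ... | nothing = contradiction (IsLeast.holds J) (minSearch-nothing e _ (IsLeast.lower J) (IsLeast.upper J))
  ... | just i  = cong just (IsLeast-unique (minSearch-just e) J)

  fromMaybe-minSearch : ∀ {lo hi j} d → P j → lo ≤ j → j < hi →
                        IsLeast P lo hi (fromMaybe d (minSearch p lo (hi ∸ lo)))
  fromMaybe-minSearch {lo} {hi} d Pj lo≤j j<hi with minSearch p lo (hi ∸ lo) in e
  ... | nothing = contradiction Pj (minSearch-nothing e _ lo≤j j<hi)
  ... | just i  = minSearch-just e

  maxSearch-just : ∀ {lo hi j} → maxSearch p lo (hi ∸ lo) ≡ just j → IsGreatest P lo hi j
  maxSearch-just {lo} {hi} e = record
    { holds = holds ; lower = lower ; upper = <-+∸⇒< lower upper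
    ; maximal = λ k j<k k<hi → maximal k j<k (<⇒<-+∸ lo k<hi) }
    where open IsGreatest (maxSearch-just′ lo (hi ∸ lo) e)

  maxSearch-greatest : ∀ {lo hi j} → IsGreatest P lo hi j → maxSearch p lo (hi ∸ lo) ≡ just j
  maxSearch-greatest {lo} {hi} J with maxSearch p lo (hi ∸ lo) in e
  ... | nothing = contradiction (IsGreatest.holds J)
                    (maxSearch-nothing′ lo (hi ∸ lo) e _ (IsGreatest.lower J) (<⇒<-+∸ lo (IsGreatest.upper J)))
  ... | just i  = cong just (IsGreatest-unique (maxSearch-just e) J)

  fromMaybe-maxSearch : ∀ {lo hi j} d → P j → lo ≤ j → j < hi →
                        IsGreatest P lo hi (fromMaybe d (maxSearch p lo (hi ∸ lo)))
  fromMaybe-maxSearch {lo} {hi} d Pj lo≤j j<hi with maxSearch p lo (hi ∸ lo) in e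
  ... | nothing = contradiction Pj (maxSearch-nothing′ lo (hi ∸ lo) e _ lo≤j (<⇒<-+∸ lo j<hi))
  ... | just i  = maxSearch-just e

  allRange-reflects : ∀ lo hi → Reflects (∀ k → lo ≤ k → k < hi → P k) (allRange p lo (hi ∸ lo))
  allRange-reflects lo hi with allRange p lo (hi ∸ lo) | allRange-reflects′ lo (hi ∸ lo)
  ... | true  | ofʸ all = ofʸ λ k lo≤k k<hi → all k lo≤k (<⇒<-+∸ lo k<hi)
  ... | false | ofⁿ ¬all = ofⁿ λ all → ¬all λ k lo≤k k< → all k lo≤k (<-+∸⇒< lo≤k k<)

-- The paper's t, r, s and x are the least Descent, the least j with w_{t+1} < w_j, the greatest SwEnd and
-- the greatest InsertionPoint in the ranges scanned by the definitions.
Descent : List ℕ → ℕ → Set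
Descent w j = at w (suc j) < at w j

SwEnd : List ℕ → ℕ → ℕ → ℕ → Set
SwEnd w t r j = Descending (at w) (suc t) j × at w (r ∸ 1) < at w j

InsertionPoint : List ℕ → List ℕ → ℕ → Set
InsertionPoint a b j = Ascending (at a) 1 j × (j ≡ 0 ⊎ at a j < at b (length b))

module _ (w : List ℕ) where

  private
    descent? : ∀ j → Reflects (Descent w j) (at w (suc j) <ᵇ at w j)
    descent? j = <ᵇ-reflects-< _ _

    exceeds? : ∀ t j → Reflects (at w (suc t) < at w j) (at w (suc t) <ᵇ at w j)
    exceeds? t j = <ᵇ-reflects-< _ _

    swEnd? : ∀ t r j → Reflects (SwEnd w t r j) _
    swEnd? t r j = allRange-reflects (λ k → <ᵇ-reflects-< (at w (suc k)) (at w k)) (suc t) j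
                   ×-reflects <ᵇ-reflects-< _ _

  firstDescent-nothing : firstDescent w ≡ nothing → ∀ k → 1 ≤ k → k < length w → ¬ Descent w k
  firstDescent-nothing = minSearch-nothing descent?

  firstDescent-just : ∀ {t} → firstDescent w ≡ just t → IsLeast (Descent w) 1 (length w) t
  firstDescent-just = minSearch-just descent?

  firstDescent-least : ∀ {t} → IsLeast (Descent w) 1 (length w) t → firstDescent w ≡ just t
  firstDescent-least = minSearch-least descent?

  rIdx-least : ∀ {t} → 1 ≤ t → Descent w t → IsLeast (λ j → at w (suc t) < at w j) 1 (suc t) (rIdx w t)
  rIdx-least {t} 1≤t desc = fromMaybe-minSearch (exceeds? t) t desc 1≤t ≤-refl

  rIdx-≡ : ∀ {t r} → IsLeast (λ j → at w (suc t) < at w j) 1 (suc t) r → rIdx w t ≡ r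
  rIdx-≡ {t} R = cong (fromMaybe t) (minSearch-least (exceeds? t) R)

  sIdx-greatest : ∀ {t r} → t < length w → at w (r ∸ 1) < at w (suc t) →
                  IsGreatest (SwEnd w t r) (suc t) (suc (length w)) (sIdx w t r)
  sIdx-greatest {t} {r} t<n below = fromMaybe-maxSearch (swEnd? t r) (suc t) (empty , below) ≤-refl (s≤s t<n)
    where
    empty : Descending (at w) (suc t) (suc t)
    empty k st≤k k<st = contradiction st≤k (<⇒≱ k<st)

  sIdx-≡ : ∀ {t r s} → IsGreatest (SwEnd w t r) (suc t) (suc (length w)) s → sIdx w t r ≡ s
  sIdx-≡ {t} {r} S = cong (fromMaybe (suc t)) (maxSearch-greatest (swEnd? t r) S)

  sw-just : ∀ {t} → firstDescent w ≡ just t →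
            sw w ≡ take (suc (sIdx w t (rIdx w t)) ∸ rIdx w t) (drop (rIdx w t ∸ 1) w)
  sw-just e rewrite e = refl

  swRest-just : ∀ {t} → firstDescent w ≡ just t →
                swRest w ≡ take (rIdx w t ∸ 1) w ++ drop (sIdx w t (rIdx w t)) w
  swRest-just e rewrite e = refl

module _ (a b : List ℕ) where

  private
    insertionPoint? : ∀ j → Reflects (InsertionPoint a b j) _
    insertionPoint? j =
      allRange-reflects (λ k → <ᵇ-reflects-< (at a k) (at a (suc k))) 1 j
      ×-reflects (fromEquivalence (≡ᵇ⇒≡ j 0) (≡⇒≡ᵇ j 0) ⊎-reflects <ᵇ-reflects-< _ _)

  insIdx-greatest : IsGreatest (InsertionPoint a b) 0 (suc (length a)) (insIdx a b)
  insIdx-greatest = fromMaybe-maxSearch insertionPoint? 0 (empty , inj₁ refl) z≤n z<s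
    where
    empty : Ascending (at a) 1 0
    empty k _ ()

  insIdx-≡ : ∀ {x} → IsGreatest (InsertionPoint a b) 0 (suc (length a)) x → insIdx a b ≡ x
  insIdx-≡ X = cong (fromMaybe 0) (maxSearch-greatest insertionPoint? X)

-- length xs is the x of ins (xs ++ zs) ys; since at xs 0 = 0 this also covers xs = [].
record Insertable (xs ys zs : List ℕ) : Set where
  field
    ascending : Ascending (at xs) 1 (length xs)
    below     : at xs (length xs) < at ys (length ys)
    blocked   : ¬ (at xs (length xs) < at zs 1 × at zs 1 < at ys (length ys))

positive-ascending : ∀ {xs k} → All (0 <_) xs → k ≤ length xs → Ascending (at xs) 1 k → Ascending (at xs) 0 k
positive-ascending pos k≤n asc zero    _ 0<k = at-All pos ≤-refl (≤-trans 0<k k≤n)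
positive-ascending pos k≤n asc (suc i) _ i<k = asc (suc i) z<s i<k

module _ {xs ys zs : List ℕ} (pos : All (0 <_) (xs ++ zs)) (I : Insertable xs ys zs) where
  open Insertable I

  private
    n : ℕ
    n = length xs
    as : List ℕ
    as = xs ++ zs

    n≤length : n ≤ length as
    n≤length = subst (n ≤_) (sym (length-++ xs)) (m≤m+n n (length zs))

    at-as-n : at as n ≡ at xs n
    at-as-n = at-++ˡ xs ≤-refl

    no-later-point : ∀ k → n < k → k < suc (length as) → ¬ InsertionPoint as ys k
    no-later-point k n<k k≤ (_   , inj₁ refl) = contradiction n<k λ ()
    no-later-point k n<k k≤ (asc , inj₂ last) = blocked (step , subst (_< _) (at-++-length xs) next<)
      where
      asc₀ : Ascending (at as) 0 k
      asc₀ = positive-ascending pos (s≤s⁻¹ k≤) asc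
      step : at xs n < at zs 1
      step = subst₂ _<_ at-as-n (at-++-length xs) (asc₀ n z≤n n<k)
      next< : at as (suc n) < at ys (length ys)
      next< = ≤-<-trans (ascending⇒≤ asc₀ z≤n n<k ≤-refl) last

  insIdx-insertable : insIdx as ys ≡ n
  insIdx-insertable = insIdx-≡ as ys record
    { holds   = chain-cong {R = _<_} (λ k _ k≤n → sym (at-++ˡ xs k≤n)) ascending , inj₂ (subst (_< _) (sym at-as-n) below)
    ; lower   = z≤n
    ; upper   = s≤s n≤length
    ; maximal = no-later-point }

  ins-insertable : ins as ys ≡ xs ++ ys ++ zs
  ins-insertable = begin
    ins as ys
      ≡⟨ cong (λ x → take x as ++ ys ++ drop x as) insIdx-insertable ⟩
    take n as ++ ys ++ drop n as
      ≡⟨ cong₂ (λ us vs → us ++ ys ++ vs) (take-length-++ xs) (drop-length-++ xs) ⟩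
    xs ++ ys ++ zs ∎
    where open ≡-Reasoning

module WaveInsertion {xs ys zs : List ℕ} (I : Insertable xs ys zs)
  {c : ℕ} (1≤c : 1 ≤ c) (c<q : c < length ys)
  (rise : Ascending (at ys) 1 c) (fall : at ys (suc c) < at ys 1) (tail : Descending (at ys) (suc c) (length ys))
  where

  open Insertable I

  private
    n q t : ℕ
    n = length xs
    q = length ys
    t = n + c
    w : List ℕ
    w = xs ++ ys ++ zs

    1≤q : 1 ≤ q
    1≤q = ≤-trans 1≤c (<⇒≤ c<q)

    length-w : length w ≡ n + (q + length zs)
    length-w = trans (length-++ xs) (cong (n +_) (length-++ ys))

    at-xs : ∀ {i} → i ≤ n → at w i ≡ at xs i
    at-xs = at-++ˡ xs

    at-ys : ∀ {j} → 1 ≤ j → j ≤ q → at w (n + j) ≡ at ys j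
    at-ys 1≤j j≤q = trans (at-++ʳ′ xs 1≤j) (at-++ˡ ys j≤q)

    at-ys-suc : ∀ {j} → j < q → at w (suc (n + j)) ≡ at ys (suc j)
    at-ys-suc j<q = trans (at-++ʳ xs _) (at-++ˡ ys j<q)

    at-ys-first : at w (suc n) ≡ at ys 1
    at-ys-first = trans (at-++-length xs) (at-++ˡ ys 1≤q)

    at-zs : at w (suc (n + q)) ≡ at zs 1
    at-zs = trans (at-++ʳ xs q) (at-++-length ys)

    xs<peak : at xs n < at ys (suc c)
    xs<peak = <-≤-trans below (descending⇒≥ tail ≤-refl c<q ≤-refl)

    ys-in-w : ∀ {R : Rel ℕ 0ℓ} {i j} → 1 ≤ i → j ≤ q → Chain R (at ys) i j → Chain R (at w) (n + i) (n + j)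
    ys-in-w {R} 1≤i j≤q ch =
      chain-++ʳ {R = R} xs 1≤i (chain-cong {R = R} (λ k _ k≤j → sym (at-++ˡ ys {zs} (≤-trans k≤j j≤q))) ch)

    ascending-to-peak : Ascending (at w) 1 t
    ascending-to-peak = chain-join {R = _<_} prefix step (subst (λ i → Ascending (at w) i t) (+-comm n 1) (ys-in-w {R = _<_} ≤-refl (<⇒≤ c<q) rise))
      where
      prefix : Ascending (at w) 1 n
      prefix = chain-cong {R = _<_} (λ k _ k≤n → sym (at-xs k≤n)) ascending
      step : at w n < at w (suc n)
      step = subst₂ _<_ (sym (at-xs ≤-refl)) (sym at-ys-first) (<-trans xs<peak fall)

  first-descent : IsLeast (Descent w) 1 (length w) t
  first-descent = record
    { holds   = subst₂ _<_ (sym (at-ys-suc c<q)) (sym (at-ys 1≤c (<⇒≤ c<q)))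
                  (<-≤-trans fall (ascending⇒≤ rise ≤-refl 1≤c ≤-refl))
    ; lower   = ≤-trans 1≤c (m≤n+m c n)
    ; upper   = subst (t <_) (sym length-w) (+-monoʳ-< n (<-≤-trans c<q (m≤m+n q (length zs))))
    ; minimal = λ k 1≤k k<t → <⇒≯ (ascending-to-peak k 1≤k k<t) }

  wave-start : IsLeast (λ j → at w (suc t) < at w j) 1 (suc t) (suc n)
  wave-start = record
    { holds   = subst₂ _<_ (sym (at-ys-suc c<q)) (sym at-ys-first) fall
    ; lower   = s≤s z≤n
    ; upper   = s≤s (m<m+n n 1≤c)
    ; minimal = λ k 1≤k k≤n → <⇒≯ (subst₂ _<_ (sym (at-xs (s≤s⁻¹ k≤n))) (sym (at-ys-suc c<q))
                  (≤-<-trans (ascending⇒≤ ascending 1≤k (s≤s⁻¹ k≤n) ≤-refl) xs<peak)) }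

  wave-end : IsGreatest (SwEnd w t (suc n)) (suc t) (suc (length w)) (n + q)
  wave-end = record
    { holds   = descending , subst₂ _<_ (sym (at-xs ≤-refl)) (sym (at-ys 1≤q ≤-refl)) below
    ; lower   = t<n+q
    ; upper   = s≤s (subst (n + q ≤_) (sym (trans length-w (sym (+-assoc n q _)))) (m≤m+n (n + q) _))
    ; maximal = no-longer-wave }
    where
    descending : Descending (at w) (suc t) (n + q)
    descending = subst (λ i → Descending (at w) i (n + q)) (+-suc n c) (ys-in-w {R = _>_} (s≤s z≤n) ≤-refl tail)
    t<n+q : suc t ≤ n + q
    t<n+q = subst (_≤ n + q) (+-suc n c) (+-monoʳ-≤ n c<q)
    no-longer-wave : ∀ k → n + q < k → k < suc (length w) → ¬ SwEnd w t (suc n) k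
    no-longer-wave k n+q<k _ (desc , xs<k) = blocked (xs<zs , zs<ys)
      where
      zs<ys : at zs 1 < at ys q
      zs<ys = subst₂ _<_ at-zs (at-ys 1≤q ≤-refl) (desc (n + q) t<n+q n+q<k)
      xs<zs : at xs n < at zs 1
      xs<zs = subst₂ _<_ (at-xs ≤-refl) at-zs
                (<-≤-trans xs<k (descending⇒≥ desc (≤-trans t<n+q (n≤1+n _)) n+q<k ≤-refl))

  sw-≡ : sw w ≡ ys
  sw-≡ = begin
    sw w
      ≡⟨ sw-just w (firstDescent-least w first-descent) ⟩
    take (suc (sIdx w t (rIdx w t)) ∸ rIdx w t) (drop (rIdx w t ∸ 1) w)
      ≡⟨ cong (λ r → take (suc (sIdx w t r) ∸ r) (drop (r ∸ 1) w)) (rIdx-≡ w wave-start) ⟩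
    take (suc (sIdx w t (suc n)) ∸ suc n) (drop n w)
      ≡⟨ cong (λ s → take (suc s ∸ suc n) (drop n w)) (sIdx-≡ w {r = suc n} wave-end) ⟩
    take (n + q ∸ n) (drop n w)
      ≡⟨ cong₂ take (m+n∸m≡n n q) (drop-length-++ xs) ⟩
    take q (ys ++ zs)
      ≡⟨ take-length-++ ys ⟩
    ys ∎
    where open ≡-Reasoning

  swRest-≡ : swRest w ≡ xs ++ zs
  swRest-≡ = begin
    swRest w
      ≡⟨ swRest-just w (firstDescent-least w first-descent) ⟩
    take (rIdx w t ∸ 1) w ++ drop (sIdx w t (rIdx w t)) w
      ≡⟨ cong (λ r → take (r ∸ 1) w ++ drop (sIdx w t r) w) (rIdx-≡ w wave-start) ⟩
    take n w ++ drop (sIdx w t (suc n)) w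
      ≡⟨ cong (λ s → take n w ++ drop s w) (sIdx-≡ w {r = suc n} wave-end) ⟩
    take n w ++ drop (n + q) w
      ≡⟨ cong₂ _++_ (take-length-++ xs) drop-n+q ⟩
    xs ++ zs ∎
    where
    open ≡-Reasoning
    drop-n+q : drop (n + q) w ≡ zs
    drop-n+q = trans (sym (drop-drop n q w)) (trans (cong (drop q) (drop-length-++ xs)) (drop-length-++ ys))

sw-insertable : ∀ {xs ys zs} → IsWave ys → Insertable xs ys zs →
                sw (xs ++ ys ++ zs) ≡ ys × swRest (xs ++ ys ++ zs) ≡ xs ++ zs
sw-insertable (c , 1≤c , c<q , _ , rise , fall , tail) I = sw-≡ , swRest-≡
  where open WaveInsertion I 1≤c c<q rise fall tail

insertable-insIdx : ∀ a b → 0 < at b (length b) → Insertable (take (insIdx a b) a) b (drop (insIdx a b) a)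
insertable-insIdx a b 0<last = record
  { ascending = subst (Ascending (at pre) 1) (sym length-pre)
                  (chain-cong {R = _<_} (λ k _ k≤x → sym (at-take x a k≤x)) (proj₁ holds))
  ; below     = subst (_< _) (sym at-pre-last) ax<last
  ; blocked   = λ (x<next , next<last) →
      let ax<ax+1 = subst₂ _<_ at-pre-last at-next x<next
      in maximal (suc x) ≤-refl (s≤s (0<at⇒≤length a (≤-<-trans z≤n ax<ax+1)))
           (chain-snoc {R = _<_} (proj₁ holds) ax<ax+1 , inj₂ (subst (_< _) at-next next<last)) }
  where
  x : ℕ
  x = insIdx a b
  pre : List ℕ
  pre = take x a
  open IsGreatest (insIdx-greatest a b)

  length-pre : length pre ≡ x
  length-pre = length-take-≤ x a (s≤s⁻¹ upper)

  at-pre-last : at pre (length pre) ≡ at a x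
  at-pre-last = trans (cong (at pre) length-pre) (at-take x a ≤-refl)

  at-next : at (drop x a) 1 ≡ at a (suc x)
  at-next = trans (at-drop x a z<s) (cong (at a) (+-comm x 1))

  ax<last : at a x < at b (length b)
  ax<last with proj₂ holds
  ... | inj₁ x≡0 = subst (λ i → at a i < _) (sym x≡0) 0<last
  ... | inj₂ ax< = ax<

sw-ins : ∀ a b → All (0 <_) b → IsWave b → sw (ins a b) ≡ b × swRest (ins a b) ≡ a
sw-ins a b pos wave@(c , 1≤c , c<q , _) =
  proj₁ inserted , trans (proj₂ inserted) (take++drop≡id (insIdx a b) a)
  where
  inserted : sw (ins a b) ≡ b × swRest (ins a b) ≡ take (insIdx a b) a ++ drop (insIdx a b) a
  inserted = sw-insertable wave (insertable-insIdx a b (at-All pos (≤-trans 1≤c (<⇒≤ c<q)) ≤-refl))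

module SpecialWave {w : List ℕ} (w∈W : InW w) {t : ℕ} (T : IsLeast (Descent w) 1 (length w) t) where

  private
    L : ℕ
    L = length w
    pos : All (0 <_) w
    pos = proj₁ w∈W
    uniq : Unique w
    uniq = proj₂ w∈W
    open IsLeast T

  ascending-to-t : Ascending (at w) 1 t
  ascending-to-t k 1≤k k<t = unique-≯⇒< uniq 1≤k ≤-refl (≤-trans k<t (<⇒≤ upper)) (minimal k 1≤k k<t)

  WaveStart : ℕ → Set
  WaveStart = IsLeast (λ j → at w (suc t) < at w j) 1 (suc t)

  WaveEnd : ℕ → ℕ → Set
  WaveEnd r = IsGreatest (SwEnd w t r) (suc t) (suc L)

  below-wave-start : ∀ {r} → WaveStart r → at w (r ∸ 1) < at w (suc t)
  below-wave-start {suc zero}    R = at-All pos z<s upper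
  below-wave-start {suc (suc r)} R =
    unique-≯⇒< uniq z<s (<⇒≤ (IsLeast.upper R)) upper (IsLeast.minimal R (suc r) z<s ≤-refl)

  split : ∀ {r s} → WaveStart r → WaveEnd r s →
          take (r ∸ 1) w ++ take (suc s ∸ r) (drop (r ∸ 1) w) ++ drop s w ≡ w
  split {zero}   R _ = contradiction (IsLeast.lower R) λ ()
  split {suc r′} R S = take++take++drop w (≤-trans (<⇒≤ (s≤s⁻¹ (IsLeast.upper R))) (<⇒≤ (IsGreatest.lower S)))

  insertable : ∀ {r s} → WaveStart r → WaveEnd r s →
               Insertable (take (r ∸ 1) w) (take (suc s ∸ r) (drop (r ∸ 1) w)) (drop s w)
  insertable {zero}   R _ = contradiction (IsLeast.lower R) λ ()
  insertable {suc r′} {s} R S = record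
    { ascending = subst (Ascending (at xs) 1) (sym length-xs)
                    (chain-cong {R = _<_} (λ k _ k≤r′ → sym (at-take r′ w k≤r′))
                      (λ k 1≤k k<r′ → ascending-to-t k 1≤k (<-trans k<r′ r′<t)))
    ; below     = subst₂ _<_ (sym xs-last) (sym ys-last) (proj₂ (IsGreatest.holds S))
    ; blocked   = λ (xs<zs , zs<ys) →
        let wr′<ws+1 = subst₂ _<_ xs-last zs-first xs<zs
        in IsGreatest.maximal S (suc s) ≤-refl (s≤s (0<at⇒≤length w (≤-<-trans z≤n wr′<ws+1)))
             (chain-snoc {R = _>_} (proj₁ (IsGreatest.holds S)) (subst₂ _<_ zs-first ys-last zs<ys) , wr′<ws+1) }
    where
    xs ys : List ℕ
    xs = take r′ w
    ys = take (s ∸ r′) (drop r′ w)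

    r′<t : r′ < t
    r′<t = s≤s⁻¹ (IsLeast.upper R)
    r′<s : r′ < s
    r′<s = <-trans r′<t (IsGreatest.lower S)
    s≤L : s ≤ L
    s≤L = s≤s⁻¹ (IsGreatest.upper S)

    length-xs : length xs ≡ r′
    length-xs = length-take-≤ r′ w (≤-trans (<⇒≤ r′<s) s≤L)
    length-ys : length ys ≡ s ∸ r′
    length-ys = length-take-≤ (s ∸ r′) (drop r′ w) (subst (s ∸ r′ ≤_) (sym (length-drop r′ w)) (∸-monoˡ-≤ r′ s≤L))

    xs-last : at xs (length xs) ≡ at w r′
    xs-last = trans (cong (at xs) length-xs) (at-take r′ w ≤-refl)
    ys-last : at ys (length ys) ≡ at w s
    ys-last = begin
      at ys (length ys)             ≡⟨ cong (at ys) length-ys ⟩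
      at ys (s ∸ r′)                ≡⟨ at-take (s ∸ r′) (drop r′ w) ≤-refl ⟩
      at (drop r′ w) (s ∸ r′)       ≡⟨ at-drop r′ w (m<n⇒0<n∸m r′<s) ⟩
      at w (r′ + (s ∸ r′))          ≡⟨ cong (at w) (m+[n∸m]≡n (<⇒≤ r′<s)) ⟩
      at w s                        ∎
      where open ≡-Reasoning
    zs-first : at (drop s w) 1 ≡ at w (suc s)
    zs-first = trans (at-drop s w z<s) (cong (at w) (+-comm s 1))

unsorted⇒descent : ∀ {w} → InW w → ¬ Linked _<_ w → ∃[ t ] firstDescent w ≡ just t
unsorted⇒descent {w} (_ , uniq) unsorted with firstDescent w in desc
... | just t  = t , refl
... | nothing = contradiction (ascending⇒linked w ascending) unsorted
  where
  ascending : Ascending (at w) 1 (length w)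
  ascending k 1≤k k<L = unique-≯⇒< uniq 1≤k ≤-refl k<L (firstDescent-nothing w desc k 1≤k k<L)

ins-sw : ∀ w → InW w → ¬ Linked _<_ w → ins (swRest w) (sw w) ≡ w
ins-sw w w∈W@(pos , _) unsorted with unsorted⇒descent w∈W unsorted
... | t , desc = begin
  ins (swRest w) (sw w)
    ≡⟨ cong₂ ins (swRest-just w desc) (sw-just w desc) ⟩
  ins (take (r ∸ 1) w ++ drop s w) (take (suc s ∸ r) (drop (r ∸ 1) w))
    ≡⟨ ins-insertable (++⁺ (take⁺ (r ∸ 1) pos) (drop⁺ s pos)) (insertable R S) ⟩
  take (r ∸ 1) w ++ take (suc s ∸ r) (drop (r ∸ 1) w) ++ drop s w
    ≡⟨ split R S ⟩
  w ∎
  where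
  open ≡-Reasoning
  T : IsLeast (Descent w) 1 (length w) t
  T = firstDescent-just w desc
  open SpecialWave w∈W T
  r s : ℕ
  r = rIdx w t
  s = sIdx w t r
  R : WaveStart r
  R = rIdx-least w (IsLeast.lower T) (IsLeast.holds T)
  S : WaveEnd r s
  S = sIdx-greatest w {r = r} (IsLeast.upper T) (below-wave-start R)

proposition6p6 : ((a b : List ℕ) → InW a → InW b → Unique (a ++ b) → IsWave b →
    (sw (ins a b) ≡ b) × (swRest (ins a b) ≡ a))
    × ((w : List ℕ) → InW w → ¬ Linked _<_ w →
    ins (swRest w) (sw w) ≡ w)
proposition6p6 = (λ a b _ (pos , _) _ wave → sw-ins a b pos wave) , ins-sw
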